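{- For any matrix $A_S\in\mathbb{Z}^{m\times s}$, letting $A_{\max}$ denote the largest $1$-norm of a column of $A_S$, it holds that $\sqrt{\det(A_S\cdot A_S^\intercal)}\leq\bigl(\sqrt{s/m}\cdot A_{\max}\bigr)^m$. -}

module Defs where

open import Data.Nat as ℕ using (ℕ; zero; suc; _⊔_)
open import Data.Integer as ℤ using (ℤ; +_; -_; ∣_∣)
open import Data.Fin using (Fin; zero; suc; toℕ; punchIn)

Matrix : ℕ → ℕ → Set
Matrix m s = Fin m → Fin s → ℤ

sumℤ : (n : ℕ) → (Fin n → ℤ) → ℤ
sumℤ zero    f = + 0
sumℤ (suc n) f = f zero ℤ.+ sumℤ n (λ i → f (suc i))

sumℕ : (n : ℕ) → (Fin n → ℕ) → ℕ
sumℕ zero    f = 0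
sumℕ (suc n) f = f zero ℕ.+ sumℕ n (λ i → f (suc i))

maxℕ : (n : ℕ) → (Fin n → ℕ) → ℕ
maxℕ zero    f = 0
maxℕ (suc n) f = f zero ⊔ maxℕ n (λ i → f (suc i))

transpose : ∀ {m s} → Matrix m s → Matrix s m
transpose A i j = A j i

_·_ : ∀ {m s t} → Matrix m s → Matrix s t → Matrix m t
_·_ {s = s} A B i j = sumℤ s (λ k → A i k ℤ.* B k j)

det : (n : ℕ) → Matrix n n → ℤ
det zero    M = + 1
det (suc n) M =
  sumℤ (suc n) (λ j → ((- (+ 1)) ℤ.^ toℕ j) ℤ.* (M zero j ℤ.* det n (λ i k → M (suc i) (punchIn j k))))

colNorm1 : ∀ {m s} → Matrix m s → Fin s → ℕ
colNorm1 {m} A k = sumℕ m (λ i → ∣ A i k ∣)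

Amax : ∀ {m s} → Matrix m s → ℕ
Amax {s = s} A = maxℕ s (colNorm1 A)

module Submission where

-- Hadamard's inequality det (A Aᵀ) ≤ ∏ᵢ ‖Aᵢ‖² is proved by induction on the number of rows, by
-- fraction-free Gaussian elimination.  Let G = A Aᵀ and a = ‖A₀‖² > 0.  The row operations
-- Gᵢ ↦ a Gᵢ - Gᵢ₀ G₀ multiply det G by aᵐ and clear the first column below a, so
-- aᵐ det G = a det N with N = a · (Schur complement of a in G).  The same operations on the rows
-- of A give a matrix with Gram matrix a N, so by induction det N ≤ ∏ᵢ Nᵢᵢ, and Nᵢᵢ ≤ a ‖Aᵢ‖².
-- The row operations rest on the determinant, defined by Laplace expansion along the first row,
-- being multilinear and alternating in the rows.  AM-GM then gives mᵐ ∏ᵢ ‖Aᵢ‖² ≤ (∑ᵢ ‖Aᵢ‖²)ᵐ,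
-- and ∑ᵢ ‖Aᵢ‖² = ∑ₖ ∑ᵢ Aᵢₖ² ≤ ∑ₖ (∑ᵢ |Aᵢₖ|)² ≤ s Amax².

open import Defs
open import Data.Nat as ℕ using (ℕ; zero; suc)
import Data.Nat.Properties as ℕP
open import Data.Integer as ℤ using (ℤ; ∣_∣)
open import Data.Fin as Fin using (Fin; zero; suc; toℕ; punchIn; punchOut)
import Data.Fin.Properties as FinP
open import Data.Product using (_,_)
open import Data.Sum using (inj₁; inj₂)
open import Data.Empty using (⊥-elim)
open import Function using (_∘_; const)
open import Relation.Nullary using (yes; no)
open import Relation.Binary.PropositionalEquality
open import Algebra.Definitions.RawSemiring ℕ.+-*-rawSemiring using () renaming (product to productℕ)

‖_‖² : ∀ {s} → (Fin s → ℤ) → ℕ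
‖_‖² {s} v = sumℕ s (λ k → ∣ v k ∣ ℕ.* ∣ v k ∣)

module ArithmeticGeometricMean where

  open import Data.Nat using (_+_; _*_; _^_; _≤_)
  open import Data.Nat.Properties
  open import Data.Nat.Tactic.RingSolver using (solve-∀)
  open ≤-Reasoning

  rearrangement : ∀ {x y u v} → x ≤ y → u ≤ v → x * v + y * u ≤ x * u + y * v
  rearrangement {x} {u = u} x≤y u≤v with m≤n⇒∃[o]m+o≡n x≤y | m≤n⇒∃[o]m+o≡n u≤v
  ... | d , refl | e , refl = begin
    x * (u + e) + (x + d) * u           ≤⟨ m≤m+n _ (d * e) ⟩
    x * (u + e) + (x + d) * u + d * e   ≡⟨ expand x d u e ⟩
    x * u + (x + d) * (u + e)           ∎
    where
    expand : ∀ x d u e → x * (u + e) + (x + d) * u + d * e ≡ x * u + (x + d) * (u + e)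
    expand = solve-∀

  power-rearrangement : ∀ k a b → a * b ^ k + b * a ^ k ≤ a ^ suc k + b ^ suc k
  power-rearrangement k a b with ≤-total a b
  ... | inj₁ a≤b = rearrangement a≤b (^-monoˡ-≤ k a≤b)
  ... | inj₂ b≤a = subst₂ _≤_ (+-comm (b * a ^ k) (a * b ^ k)) (+-comm (b ^ suc k) (a ^ suc k))
                          (rearrangement b≤a (^-monoˡ-≤ k b≤a))

  weighted-amgm : ∀ n a b → suc n * (a ^ n * b) ≤ b ^ suc n + n * a ^ suc n
  weighted-amgm zero    a b = ≤-reflexive (one-step a b)
    where
    one-step : ∀ a b → 1 * (1 * b) ≡ b * 1 + 0 * (a * 1)
    one-step = solve-∀
  weighted-amgm (suc n) a b = +-cancelʳ-≤ (a * b ^ suc n) _ _ (begin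
    suc (suc n) * (a ^ suc n * b) + a * b ^ suc n
      ≡⟨ lhs n a b (a ^ n) (b ^ n) ⟩
    a * (suc n * (a ^ n * b)) + (a * b ^ suc n + b * a ^ suc n)
      ≤⟨ +-mono-≤ (*-monoʳ-≤ a (weighted-amgm n a b)) (power-rearrangement (suc n) a b) ⟩
    a * (b ^ suc n + n * a ^ suc n) + (a ^ suc (suc n) + b ^ suc (suc n))
      ≡⟨ rhs n a b (a ^ n) (b ^ n) ⟩
    b ^ suc (suc n) + suc n * a ^ suc (suc n) + a * b ^ suc n
      ∎)
    where
    lhs : ∀ n a b U V → (2 + n) * ((a * U) * b) + a * (b * V) ≡
                        a * ((1 + n) * (U * b)) + (a * (b * V) + b * (a * U))
    lhs = solve-∀
    rhs : ∀ n a b U V → a * (b * V + n * (a * U)) + (a * (a * U) + b * (b * V)) ≡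
                        b * (b * V) + (1 + n) * (a * (a * U)) + a * (b * V)
    rhs = solve-∀

  *-distrib-^ : ∀ p q k → (p * q) ^ k ≡ p ^ k * q ^ k
  *-distrib-^ p q zero    = refl
  *-distrib-^ p q (suc k) = trans (cong ((p * q) *_) (*-distrib-^ p q k)) (interchange p q (p ^ k) (q ^ k))
    where
    interchange : ∀ p q x y → (p * q) * (x * y) ≡ (p * x) * (q * y)
    interchange = solve-∀

  -- AM-GM for one copy of x and n copies of T / n.
  amgm-step : ∀ n x T → suc n ^ suc n * (x * T ^ n) ≤ n ^ n * (x + T) ^ suc n
  amgm-step zero     x T = subst₂ _≤_ (sym (lhs x)) (sym (rhs x T)) (m≤m+n x T)
    where
    lhs : ∀ x → 1 ^ 1 * (x * 1) ≡ x
    lhs = solve-∀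
    rhs : ∀ x T → 1 * ((x + T) * 1) ≡ x + T
    rhs = solve-∀
  amgm-step n@(suc _) x T = *-cancelˡ-≤ n (+-cancelʳ-≤ E _ _ (begin
    n * (S * (x * T ^ n)) + E
      ≡⟨ lhs n (suc n ^ n) (T ^ n) x T ⟩
    suc n * ((suc n ^ n * T ^ n) * (n * (x + T)))
      ≡⟨ cong (λ z → suc n * (z * (n * (x + T)))) (*-distrib-^ (suc n) T n) ⟨
    suc n * ((suc n * T) ^ n * (n * (x + T)))
      ≤⟨ weighted-amgm n (suc n * T) (n * (x + T)) ⟩
    (n * (x + T)) ^ suc n + n * (suc n * T) ^ suc n
      ≡⟨ cong₂ (λ p q → p + n * q) (*-distrib-^ n (x + T) (suc n)) (*-distrib-^ (suc n) T (suc n)) ⟩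
    n ^ suc n * (x + T) ^ suc n + n * (S * T ^ suc n)
      ≡⟨ rhs n (n ^ n) ((x + T) ^ suc n) S (T ^ n) T ⟩
    n * (n ^ n * (x + T) ^ suc n) + E
      ∎))
    where
    S E : ℕ
    S = suc n ^ suc n
    E = n * (S * (T * T ^ n))
    lhs : ∀ n C W x T → n * ((suc n * C) * (x * W)) + n * ((suc n * C) * (T * W)) ≡
                        suc n * ((C * W) * (n * (x + T)))
    lhs = solve-∀
    rhs : ∀ n D Z S W T → (n * D) * Z + n * (S * (T * W)) ≡ n * (D * Z) + n * (S * (T * W))
    rhs = solve-∀

  amgm : ∀ n (x : Fin n → ℕ) → n ^ n * productℕ x ≤ sumℕ n x ^ n
  amgm zero    x = ≤-refl
  amgm (suc n) x = *-cancelˡ-≤ (n ^ n) {{n^n≢0 n}} (begin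
    n ^ n * (S * (x zero * P))  ≡⟨ reorder (n ^ n) S (x zero) P ⟩
    S * (x zero * (n ^ n * P))  ≤⟨ *-monoʳ-≤ S (*-monoʳ-≤ (x zero) (amgm n (x ∘ suc))) ⟩
    S * (x zero * T ^ n)        ≤⟨ amgm-step n (x zero) T ⟩
    n ^ n * (x zero + T) ^ suc n ∎)
    where
    S P T : ℕ
    S = suc n ^ suc n
    P = productℕ (x ∘ suc)
    T = sumℕ n (x ∘ suc)
    n^n≢0 : ∀ n → ℕ.NonZero (n ^ n)
    n^n≢0 zero    = _
    n^n≢0 (suc n) = m^n≢0 (suc n) (suc n)
    reorder : ∀ D S x P → D * (S * (x * P)) ≡ S * (x * (D * P))
    reorder = solve-∀

module NormBounds where

  open import Data.Nat using (_+_; _*_; _^_; _≤_; z≤n)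
  open import Data.Nat.Properties
  open ArithmeticGeometricMean using (amgm; *-distrib-^)
  open import Data.Nat.Tactic.RingSolver using (solve-∀)
  open import Algebra.Properties.Semiring.Sum +-*-semiring using (sum; sum-cong-≗; ∑-comm)

  sumℕ≡sum : ∀ n (f : Fin n → ℕ) → sumℕ n f ≡ sum f
  sumℕ≡sum zero    f = refl
  sumℕ≡sum (suc n) f = cong (f zero +_) (sumℕ≡sum n (f ∘ suc))

  sumℕ-comm : ∀ m n (f : Fin m → Fin n → ℕ) →
              sumℕ m (λ i → sumℕ n (f i)) ≡ sumℕ n (λ j → sumℕ m (λ i → f i j))
  sumℕ-comm m n f = begin
    sumℕ m (λ i → sumℕ n (f i))          ≡⟨ sumℕ≡sum m _ ⟩
    sum (λ i → sumℕ n (f i))             ≡⟨ sum-cong-≗ (λ i → sumℕ≡sum n (f i)) ⟩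
    sum (λ i → sum (f i))                ≡⟨ ∑-comm f ⟩
    sum (λ j → sum (λ i → f i j))        ≡⟨ sum-cong-≗ (λ j → sumℕ≡sum m (λ i → f i j)) ⟨
    sum (λ j → sumℕ m (λ i → f i j))     ≡⟨ sumℕ≡sum n _ ⟨
    sumℕ n (λ j → sumℕ m (λ i → f i j))  ∎
    where open ≡-Reasoning

  sumℕ-mono : ∀ n {f g : Fin n → ℕ} → (∀ i → f i ≤ g i) → sumℕ n f ≤ sumℕ n g
  sumℕ-mono zero    f≤g = z≤n
  sumℕ-mono (suc n) f≤g = +-mono-≤ (f≤g zero) (sumℕ-mono n (f≤g ∘ suc))

  sumℕ-const : ∀ n c → sumℕ n (λ _ → c) ≡ n * c
  sumℕ-const zero    c = refl
  sumℕ-const (suc n) c = cong (c +_) (sumℕ-const n c)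

  sum-squares≤square-sum : ∀ n (x : Fin n → ℕ) → sumℕ n (λ i → x i * x i) ≤ sumℕ n x * sumℕ n x
  sum-squares≤square-sum zero    x = z≤n
  sum-squares≤square-sum (suc n) x = begin
    x zero * x zero + sumℕ n (λ i → x (suc i) * x (suc i))
      ≤⟨ +-monoʳ-≤ (x zero * x zero) (sum-squares≤square-sum n (x ∘ suc)) ⟩
    x zero * x zero + T * T
      ≤⟨ m≤m+n _ (2 * (x zero * T)) ⟩
    x zero * x zero + T * T + 2 * (x zero * T)
      ≡⟨ square (x zero) T ⟩
    (x zero + T) * (x zero + T)
      ∎
    where
    open ≤-Reasoning
    T : ℕ
    T = sumℕ n (x ∘ suc)
    square : ∀ a t → a * a + t * t + 2 * (a * t) ≡ (a + t) * (a + t)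
    square = solve-∀

  ≤-maxℕ : ∀ n (f : Fin n → ℕ) k → f k ≤ maxℕ n f
  ≤-maxℕ (suc n) f zero    = m≤m⊔n (f zero) _
  ≤-maxℕ (suc n) f (suc k) = ≤-trans (≤-maxℕ n (f ∘ suc) k) (m≤n⊔m (f zero) _)

  sum-‖‖²≤ : ∀ {m s} (A : Matrix m s) → sumℕ m (λ i → ‖ A i ‖²) ≤ s * (Amax A * Amax A)
  sum-‖‖²≤ {m} {s} A = begin
    sumℕ m (λ i → sumℕ s (λ k → ∣ A i k ∣ * ∣ A i k ∣))
      ≡⟨ sumℕ-comm m s (λ i k → ∣ A i k ∣ * ∣ A i k ∣) ⟩
    sumℕ s (λ k → sumℕ m (λ i → ∣ A i k ∣ * ∣ A i k ∣))
      ≤⟨ sumℕ-mono s (λ k → sum-squares≤square-sum m (λ i → ∣ A i k ∣)) ⟩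
    sumℕ s (λ k → colNorm1 A k * colNorm1 A k)
      ≤⟨ sumℕ-mono s (λ k → *-mono-≤ (≤-maxℕ s (colNorm1 A) k) (≤-maxℕ s (colNorm1 A) k)) ⟩
    sumℕ s (λ _ → Amax A * Amax A)
      ≡⟨ sumℕ-const s (Amax A * Amax A) ⟩
    s * (Amax A * Amax A)
      ∎
    where open ≤-Reasoning

  amgm-‖‖² : ∀ {m s} (A : Matrix m s) →
             m ^ m * productℕ (λ i → ‖ A i ‖²) ≤ s ^ m * Amax A ^ (2 * m)
  amgm-‖‖² {m} {s} A = begin
    m ^ m * productℕ (λ i → ‖ A i ‖²)     ≤⟨ amgm m (λ i → ‖ A i ‖²) ⟩
    sumℕ m (λ i → ‖ A i ‖²) ^ m           ≤⟨ ^-monoˡ-≤ m (sum-‖‖²≤ A) ⟩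
    (s * (Amax A * Amax A)) ^ m           ≡⟨ *-distrib-^ s (Amax A * Amax A) m ⟩
    s ^ m * (Amax A * Amax A) ^ m         ≡⟨ cong (s ^ m *_) (*-distrib-^ (Amax A) (Amax A) m) ⟩
    s ^ m * (Amax A ^ m * Amax A ^ m)     ≡⟨ cong (s ^ m *_) (^-distribˡ-+-* (Amax A) m m) ⟨
    s ^ m * Amax A ^ (m + m)              ≡⟨ cong (λ k → s ^ m * Amax A ^ (m + k)) (+-identityʳ m) ⟨
    s ^ m * Amax A ^ (2 * m)              ∎
    where open ≤-Reasoning

open NormBounds using (amgm-‖‖²)

open import Data.Integer using (+_; -_; _+_; _*_; _-_; _^_; _≤_; _<_)
import Data.Integer.Properties as ℤP
open import Data.Integer.Tactic.RingSolver using (solve-∀)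
open import Data.Vec.Functional using (updateAt)
open import Data.Vec.Functional.Properties using (updateAt-updates; updateAt-minimal)
open import Algebra.Definitions.RawSemiring ℤ.+-*-rawSemiring using () renaming (product to productℤ)
open import Algebra.Properties.Semiring.Sum ℤP.+-*-semiring
  using (sum; sum-cong-≗; ∑-distrib-+; ∑-comm; *-distribˡ-sum; sum-remove)

open ℤP.≤-Reasoning

-- Finite sums of integers

sumℤ-cong : ∀ n {f g : Fin n → ℤ} → (∀ i → f i ≡ g i) → sumℤ n f ≡ sumℤ n g
sumℤ-cong zero    eq = refl
sumℤ-cong (suc n) eq = cong₂ _+_ (eq zero) (sumℤ-cong n (eq ∘ suc))

sumℤ≡sum : ∀ n (f : Fin n → ℤ) → sumℤ n f ≡ sum f
sumℤ≡sum zero    f = refl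
sumℤ≡sum (suc n) f = cong (_+_ (f zero)) (sumℤ≡sum n (f ∘ suc))

sumℤ-zero : ∀ n {f : Fin n → ℤ} → (∀ i → f i ≡ + 0) → sumℤ n f ≡ + 0
sumℤ-zero zero    eq = refl
sumℤ-zero (suc n) eq = cong₂ _+_ (eq zero) (sumℤ-zero n (eq ∘ suc))

sumℤ-distrib-+ : ∀ n (f g : Fin n → ℤ) →
                 sumℤ n (λ i → f i + g i) ≡ sumℤ n f + sumℤ n g
sumℤ-distrib-+ n f g
  rewrite sumℤ≡sum n (λ i → f i + g i) | sumℤ≡sum n f | sumℤ≡sum n g = ∑-distrib-+ f g

*-distribˡ-sumℤ : ∀ n c (f : Fin n → ℤ) → c * sumℤ n f ≡ sumℤ n (λ i → c * f i)
*-distribˡ-sumℤ n c f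
  rewrite sumℤ≡sum n f | sumℤ≡sum n (λ i → c * f i) = *-distribˡ-sum c f

sumℤ-linear : ∀ n a b (f g : Fin n → ℤ) →
              sumℤ n (λ i → a * f i + b * g i) ≡ a * sumℤ n f + b * sumℤ n g
sumℤ-linear n a b f g = begin-equality
  sumℤ n (λ i → a * f i + b * g i)
    ≡⟨ sumℤ-distrib-+ n (λ i → a * f i) (λ i → b * g i) ⟩
  sumℤ n (λ i → a * f i) + sumℤ n (λ i → b * g i)
    ≡⟨ cong₂ _+_ (*-distribˡ-sumℤ n a f) (*-distribˡ-sumℤ n b g) ⟨
  a * sumℤ n f + b * sumℤ n g
    ∎

sumℤ-neg : ∀ n (f : Fin n → ℤ) → sumℤ n (λ i → - f i) ≡ - sumℤ n f
sumℤ-neg n f = begin-equality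
  sumℤ n (λ i → - f i)          ≡⟨ sumℤ-cong n (λ i → ℤP.-1*i≡-i (f i)) ⟨
  sumℤ n (λ i → - + 1 * f i)    ≡⟨ *-distribˡ-sumℤ n (- + 1) f ⟨
  - + 1 * sumℤ n f              ≡⟨ ℤP.-1*i≡-i (sumℤ n f) ⟩
  - sumℤ n f                    ∎

sumℤ-comm : ∀ m n (f : Fin m → Fin n → ℤ) →
            sumℤ m (λ i → sumℤ n (f i)) ≡ sumℤ n (λ j → sumℤ m (λ i → f i j))
sumℤ-comm m n f = begin-equality
  sumℤ m (λ i → sumℤ n (f i))          ≡⟨ sumℤ≡sum m _ ⟩
  sum (λ i → sumℤ n (f i))             ≡⟨ sum-cong-≗ (λ i → sumℤ≡sum n (f i)) ⟩
  sum (λ i → sum (f i))                ≡⟨ ∑-comm f ⟩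
  sum (λ j → sum (λ i → f i j))        ≡⟨ sum-cong-≗ (λ j → sumℤ≡sum m (λ i → f i j)) ⟨
  sum (λ j → sumℤ m (λ i → f i j))     ≡⟨ sumℤ≡sum n _ ⟨
  sumℤ n (λ j → sumℤ m (λ i → f i j))  ∎

sumℤ-punchIn : ∀ n (j : Fin (suc n)) (f : Fin (suc n) → ℤ) →
               sumℤ (suc n) f ≡ f j + sumℤ n (f ∘ punchIn j)
sumℤ-punchIn n j f
  rewrite sumℤ≡sum (suc n) f | sumℤ≡sum n (f ∘ punchIn j) = sum-remove {i = j} f

-- Multilinearity of the Laplace expansion

sign : ∀ {n} → Fin n → ℤ
sign j = (- + 1) ^ toℕ j

minor : ∀ {n} → Matrix (suc n) (suc n) → Fin (suc n) → Matrix n n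
minor M j i k = M (suc i) (punchIn j k)

-- det (suc n) M is definitionally sumℤ (suc n) (laplaceTerm M).
laplaceTerm : ∀ {n} → Matrix (suc n) (suc n) → Fin (suc n) → ℤ
laplaceTerm {n} M j = sign j * (M zero j * det n (minor M j))

det-cong : ∀ n {M N : Matrix n n} → (∀ i j → M i j ≡ N i j) → det n M ≡ det n N
det-cong zero    eq = refl
det-cong (suc n) eq = sumℤ-cong (suc n) λ j →
  cong₂ (λ x d → sign j * (x * d)) (eq zero j) (det-cong n (λ i k → eq (suc i) (punchIn j k)))

laplace-linear : ∀ {n} a b (M N P : Matrix (suc n) (suc n)) →
                 (∀ j → laplaceTerm M j ≡ a * laplaceTerm N j + b * laplaceTerm P j) →
                 det (suc n) M ≡ a * det (suc n) N + b * det (suc n) P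
laplace-linear {n} a b M N P terms =
  trans (sumℤ-cong (suc n) terms) (sumℤ-linear (suc n) a b (laplaceTerm N) (laplaceTerm P))

det-linear-row : ∀ n (r : Fin n) a b (M N P : Matrix n n) →
                 (∀ i → i ≢ r → ∀ j → M i j ≡ N i j) →
                 (∀ i → i ≢ r → ∀ j → M i j ≡ P i j) →
                 (∀ j → M r j ≡ a * N r j + b * P r j) →
                 det n M ≡ a * det n N + b * det n P
det-linear-row (suc n) zero a b M N P eqN eqP eqr = laplace-linear a b M N P λ j → begin-equality
  sign j * (M zero j * det n (minor M j))
    ≡⟨ cong (λ x → sign j * (x * det n (minor M j))) (eqr j) ⟩
  sign j * ((a * N zero j + b * P zero j) * det n (minor M j))
    ≡⟨ distrib a b (sign j) (N zero j) (P zero j) (det n (minor M j)) ⟩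
  a * (sign j * (N zero j * det n (minor M j))) + b * (sign j * (P zero j * det n (minor M j)))
    ≡⟨ cong₂ (λ dN dP → a * (sign j * (N zero j * dN)) + b * (sign j * (P zero j * dP)))
             (det-cong n (λ i k → eqN (suc i) (λ ()) _)) (det-cong n (λ i k → eqP (suc i) (λ ()) _)) ⟩
  a * laplaceTerm N j + b * laplaceTerm P j
    ∎
  where
  distrib : ∀ a b s x y d → s * ((a * x + b * y) * d) ≡ a * (s * (x * d)) + b * (s * (y * d))
  distrib = solve-∀
det-linear-row (suc n) (suc r) a b M N P eqN eqP eqr = laplace-linear a b M N P λ j → begin-equality
  sign j * (M zero j * det n (minor M j))
    ≡⟨ cong (λ d → sign j * (M zero j * d))
            (det-linear-row n r a b (minor M j) (minor N j) (minor P j)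
               (λ i i≢r k → eqN (suc i) (i≢r ∘ FinP.suc-injective) _)
               (λ i i≢r k → eqP (suc i) (i≢r ∘ FinP.suc-injective) _)
               (λ k → eqr _)) ⟩
  sign j * (M zero j * (a * det n (minor N j) + b * det n (minor P j)))
    ≡⟨ distrib a b (sign j) (M zero j) (det n (minor N j)) (det n (minor P j)) ⟩
  a * (sign j * (M zero j * det n (minor N j))) + b * (sign j * (M zero j * det n (minor P j)))
    ≡⟨ cong₂ (λ x y → a * (sign j * (x * det n (minor N j))) + b * (sign j * (y * det n (minor P j))))
             (eqN zero (λ ()) j) (eqP zero (λ ()) j) ⟩
  a * laplaceTerm N j + b * laplaceTerm P j
    ∎
  where
  distrib : ∀ a b s x dN dP → s * (x * (a * dN + b * dP)) ≡ a * (s * (x * dN)) + b * (s * (x * dP))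
  distrib = solve-∀

det-additive-row : ∀ n (r : Fin n) (M N P : Matrix n n) →
                   (∀ i → i ≢ r → ∀ j → M i j ≡ N i j) →
                   (∀ i → i ≢ r → ∀ j → M i j ≡ P i j) →
                   (∀ j → M r j ≡ N r j + P r j) →
                   det n M ≡ det n N + det n P
det-additive-row n r M N P eqN eqP eqr = begin-equality
  det n M
    ≡⟨ det-linear-row n r (+ 1) (+ 1) M N P eqN eqP (λ j → trans (eqr j) (unit-coefficients (N r j) (P r j))) ⟩
  + 1 * det n N + + 1 * det n P
    ≡⟨ unit-coefficients (det n N) (det n P) ⟨
  det n N + det n P
    ∎
  where
  unit-coefficients : ∀ x y → x + y ≡ + 1 * x + + 1 * y
  unit-coefficients = solve-∀

det-zero-row : ∀ n (r : Fin n) (M : Matrix n n) → (∀ j → M r j ≡ + 0) → det n M ≡ + 0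
det-zero-row n r M zero-row = begin-equality
  det n M
    ≡⟨ det-linear-row n r (+ 0) (+ 0) M M M (λ _ _ _ → refl) (λ _ _ _ → refl)
                      (λ j → trans (zero-row j) (zero-coefficients (M r j))) ⟩
  + 0 * det n M + + 0 * det n M
    ≡⟨ zero-coefficients (det n M) ⟨
  + 0
    ∎
  where
  zero-coefficients : ∀ x → + 0 ≡ + 0 * x + + 0 * x
  zero-coefficients = solve-∀

laplaceTerm-vanishes : ∀ {n} (M : Matrix (suc n) (suc n)) j →
                       det n (minor M j) ≡ + 0 → laplaceTerm M j ≡ + 0
laplaceTerm-vanishes {n} M j minor≡0 = begin-equality
  sign j * (M zero j * det n (minor M j))  ≡⟨ cong (λ d → sign j * (M zero j * d)) minor≡0 ⟩
  sign j * (M zero j * + 0)                ≡⟨ cong (sign j *_) (ℤP.*-zeroʳ (M zero j)) ⟩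
  sign j * + 0                             ≡⟨ ℤP.*-zeroʳ (sign j) ⟩
  + 0                                      ∎

-- The determinant is alternating

self-negating⇒zero : ∀ x → x ≡ - x → x ≡ + 0
self-negating⇒zero x x≡-x with ℤP.i*j≡0⇒i≡0∨j≡0 (+ 2) double≡0
  where
  double≡0 : + 2 * x ≡ + 0
  double≡0 = begin-equality
    + 2 * x            ≡⟨ ℤP.*-distribʳ-+ x (+ 1) (+ 1) ⟩
    + 1 * x + + 1 * x  ≡⟨ cong₂ _+_ (ℤP.*-identityˡ x) (trans (ℤP.*-identityˡ x) x≡-x) ⟩
    x + - x            ≡⟨ ℤP.+-inverseʳ x ⟩
    + 0                ∎
... | inj₂ x≡0 = x≡0

antisymmetric-double-sum : ∀ n (g : Fin n → Fin n → ℤ) → (∀ i j → g j i ≡ - g i j) →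
                           sumℤ n (λ i → sumℤ n (g i)) ≡ + 0
antisymmetric-double-sum n g antisym = self-negating⇒zero _ (begin-equality
  sumℤ n (λ i → sumℤ n (g i))          ≡⟨ sumℤ-comm n n g ⟩
  sumℤ n (λ j → sumℤ n (λ i → g i j))  ≡⟨ sumℤ-cong n (λ j → sumℤ-cong n (antisym j)) ⟩
  sumℤ n (λ j → sumℤ n (λ i → - g j i)) ≡⟨ sumℤ-cong n (λ j → sumℤ-neg n (g j)) ⟩
  sumℤ n (λ j → - sumℤ n (g j))        ≡⟨ sumℤ-neg n _ ⟩
  - sumℤ n (λ i → sumℤ n (g i))        ∎)

sign-punchOut : ∀ {n} {j c : Fin (suc n)} (j≢c : j ≢ c) (c≢j : c ≢ j) →
                sign j * sign (punchOut j≢c) ≡ - (sign c * sign (punchOut c≢j))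
sign-punchOut {_}     {zero}  {zero}  j≢c _ = ⊥-elim (j≢c refl)
sign-punchOut {suc n} {zero}  {suc c} _   _ = flip-left (sign c)
  where
  flip-left : ∀ x → + 1 * x ≡ - ((- + 1 * x) * + 1)
  flip-left = solve-∀
sign-punchOut {suc n} {suc j} {zero}  _   _ = flip-right (sign j)
  where
  flip-right : ∀ x → (- + 1 * x) * + 1 ≡ - (+ 1 * x)
  flip-right = solve-∀
sign-punchOut {suc n} {suc j} {suc c} j≢c c≢j = begin-equality
  (- + 1 * sign j) * (- + 1 * sign (punchOut (j≢c ∘ cong suc)))
    ≡⟨ signs-cancel (sign j) (sign (punchOut (j≢c ∘ cong suc))) ⟩
  sign j * sign (punchOut (j≢c ∘ cong suc))
    ≡⟨ sign-punchOut (j≢c ∘ cong suc) (c≢j ∘ cong suc) ⟩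
  - (sign c * sign (punchOut (c≢j ∘ cong suc)))
    ≡⟨ cong -_ (signs-cancel (sign c) (sign (punchOut (c≢j ∘ cong suc)))) ⟨
  - ((- + 1 * sign c) * (- + 1 * sign (punchOut (c≢j ∘ cong suc))))
    ∎
  where
  signs-cancel : ∀ x y → (- + 1 * x) * (- + 1 * y) ≡ x * y
  signs-cancel = solve-∀

punchIn-punchIn-punchOut : ∀ {n} {j c : Fin (suc (suc n))} (j≢c : j ≢ c) (c≢j : c ≢ j) (l : Fin n) →
                           punchIn j (punchIn (punchOut j≢c) l) ≡ punchIn c (punchIn (punchOut c≢j) l)
punchIn-punchIn-punchOut {_}     {zero}  {zero}  j≢c _   _       = ⊥-elim (j≢c refl)
punchIn-punchIn-punchOut {_}     {zero}  {suc c} _   _   _       = refl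
punchIn-punchIn-punchOut {_}     {suc j} {zero}  _   _   _       = refl
punchIn-punchIn-punchOut {suc n} {suc j} {suc c} _   _   zero    = refl
punchIn-punchIn-punchOut {suc n} {suc j} {suc c} j≢c c≢j (suc l) =
  cong suc (punchIn-punchIn-punchOut (j≢c ∘ cong suc) (c≢j ∘ cong suc) l)

-- Expanding along both equal rows writes det M as a double sum over ordered pairs of distinct
-- columns, and exchanging the two columns of a pair negates its term.
module EqualFirstRows {n} (M : Matrix (suc (suc n)) (suc (suc n)))
                      (rows-equal : ∀ j → M zero j ≡ M (suc zero) j) where

  private
    r : Fin (suc (suc n)) → ℤ
    r = M zero

    D : Fin (suc (suc n)) → Fin (suc n) → ℤ
    D j k = det n (minor (minor M j) k)

    T : Fin (suc (suc n)) → Fin (suc n) → ℤ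
    T j k = sign j * (r j * (sign k * (r (punchIn j k) * D j k)))

    double-expansion : ∀ j → laplaceTerm M j ≡ sumℤ (suc n) (T j)
    double-expansion j = begin-equality
      sign j * (r j * sumℤ (suc n) (laplaceTerm (minor M j)))
        ≡⟨ cong (λ t → sign j * (r j * t))
                (sumℤ-cong (suc n) (λ k → cong (λ x → sign k * (x * D j k)) (sym (rows-equal (punchIn j k))))) ⟩
      sign j * (r j * sumℤ (suc n) (λ k → sign k * (r (punchIn j k) * D j k)))
        ≡⟨ cong (sign j *_) (*-distribˡ-sumℤ (suc n) (r j) (λ k → sign k * (r (punchIn j k) * D j k))) ⟩
      sign j * sumℤ (suc n) (λ k → r j * (sign k * (r (punchIn j k) * D j k)))
        ≡⟨ *-distribˡ-sumℤ (suc n) (sign j) (λ k → r j * (sign k * (r (punchIn j k) * D j k))) ⟩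
      sumℤ (suc n) (T j)
        ∎

    T-punchOut : ∀ {j c} (j≢c : j ≢ c) →
                 T j (punchOut j≢c) ≡ (sign j * sign (punchOut j≢c)) * (r j * r c * D j (punchOut j≢c))
    T-punchOut {j} {c} j≢c = begin-equality
      sign j * (r j * (sign k * (r (punchIn j k) * D j k)))
        ≡⟨ cong (λ z → sign j * (r j * (sign k * (r z * D j k)))) (FinP.punchIn-punchOut j≢c) ⟩
      sign j * (r j * (sign k * (r c * D j k)))
        ≡⟨ regroup (sign j) (r j) (sign k) (r c) (D j k) ⟩
      (sign j * sign k) * (r j * r c * D j k)
        ∎
      where
      k : Fin (suc n)
      k = punchOut j≢c
      regroup : ∀ a b c d e → a * (b * (c * (d * e))) ≡ (a * c) * (b * d * e)
      regroup = solve-∀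

    T-antisym : ∀ {j c} (j≢c : j ≢ c) (c≢j : c ≢ j) → T c (punchOut c≢j) ≡ - T j (punchOut j≢c)
    T-antisym {j} {c} j≢c c≢j = begin-equality
      T c (punchOut c≢j)
        ≡⟨ T-punchOut c≢j ⟩
      (sign c * sign (punchOut c≢j)) * (r c * r j * D c (punchOut c≢j))
        ≡⟨ cong₂ (λ s d → s * (r c * r j * d)) (sign-punchOut c≢j j≢c)
                 (det-cong n (λ i l → cong (M (suc (suc i))) (punchIn-punchIn-punchOut c≢j j≢c l))) ⟩
      - (sign j * sign (punchOut j≢c)) * (r c * r j * D j (punchOut j≢c))
        ≡⟨ swap-factors (sign j * sign (punchOut j≢c)) (r c) (r j) (D j (punchOut j≢c)) ⟩
      - ((sign j * sign (punchOut j≢c)) * (r j * r c * D j (punchOut j≢c)))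
        ≡⟨ cong -_ (T-punchOut j≢c) ⟨
      - T j (punchOut j≢c)
        ∎
      where
      swap-factors : ∀ s a b d → - s * (a * b * d) ≡ - (s * (b * a * d))
      swap-factors = solve-∀

    g : Fin (suc (suc n)) → Fin (suc (suc n)) → ℤ
    g j c with j Fin.≟ c
    ... | yes _   = + 0
    ... | no j≢c = T j (punchOut j≢c)

    g-diagonal : ∀ j → g j j ≡ + 0
    g-diagonal j with j Fin.≟ j
    ... | yes _   = refl
    ... | no j≢j = ⊥-elim (j≢j refl)

    g-off-diagonal : ∀ {j c} (j≢c : j ≢ c) → g j c ≡ T j (punchOut j≢c)
    g-off-diagonal {j} {c} j≢c with j Fin.≟ c
    ... | yes j≡c  = ⊥-elim (j≢c j≡c)
    ... | no _     = cong (T j) (FinP.punchOut-cong j refl)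

    g-antisym : ∀ j c → g c j ≡ - g j c
    g-antisym j c with j Fin.≟ c
    ... | yes refl = g-diagonal j
    ... | no j≢c  = begin-equality
      g c j                       ≡⟨ g-off-diagonal (j≢c ∘ sym) ⟩
      T c (punchOut (j≢c ∘ sym))  ≡⟨ T-antisym j≢c (j≢c ∘ sym) ⟩
      - T j (punchOut j≢c)        ∎

    g-row : ∀ j → sumℤ (suc (suc n)) (g j) ≡ sumℤ (suc n) (T j)
    g-row j = begin-equality
      sumℤ (suc (suc n)) (g j)                        ≡⟨ sumℤ-punchIn (suc n) j (g j) ⟩
      g j j + sumℤ (suc n) (λ k → g j (punchIn j k))  ≡⟨ cong₂ _+_ (g-diagonal j) (sumℤ-cong (suc n) g-punchIn) ⟩
      + 0 + sumℤ (suc n) (T j)                        ≡⟨ ℤP.+-identityˡ _ ⟩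
      sumℤ (suc n) (T j)                              ∎
      where
      g-punchIn : ∀ k → g j (punchIn j k) ≡ T j k
      g-punchIn k = trans (g-off-diagonal (FinP.punchInᵢ≢i j k ∘ sym)) (cong (T j) (FinP.punchOut-punchIn j))

  det-equal-first-rows : det (suc (suc n)) M ≡ + 0
  det-equal-first-rows = begin-equality
    sumℤ (suc (suc n)) (laplaceTerm M)                   ≡⟨ sumℤ-cong (suc (suc n)) double-expansion ⟩
    sumℤ (suc (suc n)) (λ j → sumℤ (suc n) (T j))        ≡⟨ sumℤ-cong (suc (suc n)) g-row ⟨
    sumℤ (suc (suc n)) (λ j → sumℤ (suc (suc n)) (g j))  ≡⟨ antisymmetric-double-sum (suc (suc n)) g g-antisym ⟩
    + 0                                                  ∎

open EqualFirstRows using (det-equal-first-rows)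

Alternating : ℕ → Set
Alternating n = ∀ (M : Matrix n n) p q → p ≢ q → (∀ j → M p j ≡ M q j) → det n M ≡ + 0

Antisymmetric : ℕ → Set
Antisymmetric n = ∀ (M N : Matrix n n) p q → p ≢ q →
                  (∀ j → N p j ≡ M q j) → (∀ j → N q j ≡ M p j) →
                  (∀ i → i ≢ p → i ≢ q → ∀ j → N i j ≡ M i j) →
                  det n N ≡ - det n M

alternating⇒antisymmetric : ∀ n → Alternating n → Antisymmetric n
alternating⇒antisymmetric n alt M N p q p≢q Np Nq Ni = opposite (begin-equality
  + 0                                   ≡⟨ equal-rows w ⟨
  det n (R w w)                         ≡⟨ split-p w ⟩
  det n (R u w) + det n (R v w)         ≡⟨ cong₂ _+_ (split-q u) (split-q v) ⟩
  (det n (R u u) + det n (R u v)) + (det n (R v u) + det n (R v v))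
    ≡⟨ cong₂ _+_ (cong₂ _+_ (equal-rows u) (det-cong n R-M)) (cong₂ _+_ (det-cong n R-N) (equal-rows v)) ⟩
  (+ 0 + det n M) + (det n N + + 0)     ∎)
  where
  u v w : Fin n → ℤ
  u = M p
  v = M q
  w j = u j + v j

  R : (Fin n → ℤ) → (Fin n → ℤ) → Matrix n n
  R x y = updateAt (updateAt M p (const x)) q (const y)

  R-p : ∀ x y j → R x y p j ≡ x j
  R-p x y j = cong-app (trans (updateAt-minimal p q _ p≢q) (updateAt-updates p M)) j

  R-q : ∀ x y j → R x y q j ≡ y j
  R-q x y j = cong-app (updateAt-updates q (updateAt M p (const x))) j

  R-other : ∀ x y i → i ≢ p → i ≢ q → ∀ j → R x y i j ≡ M i j
  R-other x y i i≢p i≢q = cong-app (trans (updateAt-minimal i q _ i≢q) (updateAt-minimal i p M i≢p))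

  equal-rows : ∀ x → det n (R x x) ≡ + 0
  equal-rows x = alt (R x x) p q p≢q (λ j → trans (R-p x x j) (sym (R-q x x j)))

  split-p : ∀ y → det n (R w y) ≡ det n (R u y) + det n (R v y)
  split-p y = det-additive-row n p (R w y) (R u y) (R v y) off-p off-p
                (λ j → trans (R-p w y j) (cong₂ _+_ (sym (R-p u y j)) (sym (R-p v y j))))
    where
    off-p : ∀ {x x′} i → i ≢ p → ∀ j → R x y i j ≡ R x′ y i j
    off-p i i≢p j with i Fin.≟ q
    ... | yes refl = trans (R-q _ y j) (sym (R-q _ y j))
    ... | no i≢q  = trans (R-other _ y i i≢p i≢q j) (sym (R-other _ y i i≢p i≢q j))

  split-q : ∀ x → det n (R x w) ≡ det n (R x u) + det n (R x v)
  split-q x = det-additive-row n q (R x w) (R x u) (R x v) off-q off-q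
                (λ j → trans (R-q x w j) (cong₂ _+_ (sym (R-q x u j)) (sym (R-q x v j))))
    where
    off-q : ∀ {y y′} i → i ≢ q → ∀ j → R x y i j ≡ R x y′ i j
    off-q i i≢q = cong-app (trans (updateAt-minimal i q (updateAt M p (const x)) i≢q)
                                  (sym (updateAt-minimal i q (updateAt M p (const x)) i≢q)))

  R-M : ∀ i j → R u v i j ≡ M i j
  R-M i j with i Fin.≟ p | i Fin.≟ q
  ... | yes refl | _        = R-p u v j
  ... | no _     | yes refl = R-q u v j
  ... | no i≢p   | no i≢q   = R-other u v i i≢p i≢q j

  R-N : ∀ i j → R v u i j ≡ N i j
  R-N i j with i Fin.≟ p | i Fin.≟ q
  ... | yes refl | _        = trans (R-p v u j) (sym (Np j))
  ... | no _     | yes refl = trans (R-q v u j) (sym (Nq j))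
  ... | no i≢p   | no i≢q   = trans (R-other v u i i≢p i≢q j) (sym (Ni i i≢p i≢q j))

  opposite : + 0 ≡ (+ 0 + det n M) + (det n N + + 0) → det n N ≡ - det n M
  opposite sum≡0 = begin-equality
    det n N                                        ≡⟨ isolate (det n M) (det n N) ⟩
    ((+ 0 + det n M) + (det n N + + 0)) - det n M  ≡⟨ cong (_- det n M) sum≡0 ⟨
    + 0 - det n M                                  ≡⟨ ℤP.+-identityˡ (- det n M) ⟩
    - det n M                                      ∎
    where
    isolate : ∀ x y → y ≡ ((+ 0 + x) + (y + + 0)) - x
    isolate = solve-∀

det-swap-lower-rows : ∀ n → Antisymmetric n →
                      ∀ (M N : Matrix (suc n) (suc n)) p q → p ≢ q →
                      (∀ j → N (suc p) j ≡ M (suc q) j) → (∀ j → N (suc q) j ≡ M (suc p) j) →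
                      (∀ i → i ≢ suc p → i ≢ suc q → ∀ j → N i j ≡ M i j) →
                      det (suc n) N ≡ - det (suc n) M
det-swap-lower-rows n antisym M N p q p≢q Np Nq Ni = begin-equality
  sumℤ (suc n) (laplaceTerm N)             ≡⟨ sumℤ-cong (suc n) term ⟩
  sumℤ (suc n) (λ j → - laplaceTerm M j)   ≡⟨ sumℤ-neg (suc n) (laplaceTerm M) ⟩
  - det (suc n) M                          ∎
  where
  negate-last : ∀ s x d → s * (x * - d) ≡ - (s * (x * d))
  negate-last = solve-∀
  term : ∀ j → laplaceTerm N j ≡ - laplaceTerm M j
  term j = begin-equality
    sign j * (N zero j * det n (minor N j))
      ≡⟨ cong₂ (λ x d → sign j * (x * d)) (Ni zero (λ ()) (λ ()) j)
               (antisym (minor M j) (minor N j) p q p≢q (λ k → Np _) (λ k → Nq _)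
                  (λ i i≢p i≢q k → Ni (suc i) (i≢p ∘ FinP.suc-injective) (i≢q ∘ FinP.suc-injective) _)) ⟩
    sign j * (M zero j * - det n (minor M j))
      ≡⟨ negate-last (sign j) (M zero j) (det n (minor M j)) ⟩
    - laplaceTerm M j
      ∎

det-equal-head-row : ∀ n → Alternating n →
                     ∀ (M : Matrix (suc n) (suc n)) q → (∀ j → M zero j ≡ M (suc q) j) →
                     det (suc n) M ≡ + 0
det-equal-head-row (suc n) alt M zero    rows-equal = det-equal-first-rows M rows-equal
det-equal-head-row (suc n) alt M (suc q) rows-equal = begin-equality
  det (suc (suc n)) M          ≡⟨ ℤP.neg-involutive _ ⟨
  - - det (suc (suc n)) M      ≡⟨ cong -_ swapped-negates ⟨
  - det (suc (suc n)) N        ≡⟨ cong -_ (det-equal-first-rows N rows-equal) ⟩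
  + 0                          ∎
  where
  N₁ N : Matrix (suc (suc n)) (suc (suc n))
  N₁ = updateAt M (suc zero) (const (M (suc (suc q))))
  N  = updateAt N₁ (suc (suc q)) (const (M (suc zero)))

  swapped-negates : det (suc (suc n)) N ≡ - det (suc (suc n)) M
  swapped-negates =
    det-swap-lower-rows (suc n) (alternating⇒antisymmetric (suc n) alt) M N zero (suc q) (λ ())
      (λ j → refl)
      (cong-app (updateAt-updates (suc (suc q)) N₁))
      (λ i i≢1 i≢q → cong-app (trans (updateAt-minimal i (suc (suc q)) N₁ i≢q)
                                     (updateAt-minimal i (suc zero) M i≢1)))

det-alternating : ∀ n → Alternating n
det-alternating (suc n) M zero    zero    p≢q _ = ⊥-elim (p≢q refl)
det-alternating (suc n) M zero    (suc q) _   rows-equal =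
  det-equal-head-row n (det-alternating n) M q rows-equal
det-alternating (suc n) M (suc p) zero    _   rows-equal =
  det-equal-head-row n (det-alternating n) M p (sym ∘ rows-equal)
det-alternating (suc n) M (suc p) (suc q) p≢q rows-equal = sumℤ-zero (suc n) λ j →
  laplaceTerm-vanishes M j (det-alternating n (minor M j) p q (p≢q ∘ cong suc) (λ k → rows-equal _))

-- Row operations

det-row-operation : ∀ n (M M′ : Matrix n n) r p → r ≢ p → ∀ a c →
                    (∀ i → i ≢ r → ∀ j → M′ i j ≡ M i j) →
                    (∀ j → M′ r j ≡ a * M r j - c * M p j) →
                    det n M′ ≡ a * det n M
det-row-operation n M M′ r p r≢p a c off-r row-r = begin-equality
  det n M′
    ≡⟨ det-linear-row n r a (- c) M′ M P off-r off-r-P row-r-linear ⟩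
  a * det n M + - c * det n P
    ≡⟨ cong (λ d → a * det n M + - c * d) (det-alternating n P r p r≢p P-rows-equal) ⟩
  a * det n M + - c * + 0
    ≡⟨ drop-zero a c (det n M) ⟩
  a * det n M
    ∎
  where
  P : Matrix n n
  P = updateAt M r (const (M p))

  P-row-r : ∀ j → P r j ≡ M p j
  P-row-r = cong-app (updateAt-updates r M)

  P-rows-equal : ∀ j → P r j ≡ P p j
  P-rows-equal j = trans (P-row-r j) (sym (cong-app (updateAt-minimal p r M (r≢p ∘ sym)) j))

  off-r-P : ∀ i → i ≢ r → ∀ j → M′ i j ≡ P i j
  off-r-P i i≢r j = trans (off-r i i≢r j) (sym (cong-app (updateAt-minimal i r M i≢r) j))

  subtraction : ∀ a x c y → a * x - c * y ≡ a * x + - c * y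
  subtraction = solve-∀

  row-r-linear : ∀ j → M′ r j ≡ a * M r j + - c * P r j
  row-r-linear j = begin-equality
    M′ r j                   ≡⟨ row-r j ⟩
    a * M r j - c * M p j    ≡⟨ subtraction a (M r j) c (M p j) ⟩
    a * M r j + - c * M p j  ≡⟨ cong (λ x → a * M r j + - c * x) (P-row-r j) ⟨
    a * M r j + - c * P r j  ∎

  drop-zero : ∀ a c d → a * d + - c * + 0 ≡ a * d
  drop-zero = solve-∀

det-scale : ∀ n c (M N : Matrix n n) → (∀ i j → M i j ≡ c * N i j) → det n M ≡ c ^ n * det n N
det-scale zero    c M N M≡cN = refl
det-scale (suc n) c M N M≡cN = begin-equality
  sumℤ (suc n) (laplaceTerm M)                      ≡⟨ sumℤ-cong (suc n) term ⟩
  sumℤ (suc n) (λ j → c ^ suc n * laplaceTerm N j)  ≡⟨ *-distribˡ-sumℤ (suc n) (c ^ suc n) (laplaceTerm N) ⟨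
  c ^ suc n * det (suc n) N                         ∎
  where
  collect : ∀ s c x cn d → s * ((c * x) * (cn * d)) ≡ (c * cn) * (s * (x * d))
  collect = solve-∀
  term : ∀ j → laplaceTerm M j ≡ c ^ suc n * laplaceTerm N j
  term j = begin-equality
    sign j * (M zero j * det n (minor M j))
      ≡⟨ cong₂ (λ x d → sign j * (x * d)) (M≡cN zero j)
               (det-scale n c (minor M j) (minor N j) (λ i k → M≡cN (suc i) _)) ⟩
    sign j * ((c * N zero j) * (c ^ n * det n (minor N j)))
      ≡⟨ collect (sign j) c (N zero j) (c ^ n) (det n (minor N j)) ⟩
    c ^ suc n * laplaceTerm N j
      ∎

det-first-column : ∀ n (M : Matrix (suc n) (suc n)) → (∀ i → M (suc i) zero ≡ + 0) →
                   det (suc n) M ≡ M zero zero * det n (minor M zero)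
det-first-column n M column-zero = begin-equality
  + 1 * (M zero zero * det n (minor M zero)) + sumℤ n (laplaceTerm M ∘ suc)
    ≡⟨ cong₂ _+_ (ℤP.*-identityˡ (M zero zero * det n (minor M zero)))
                 (sumℤ-zero n (lower-terms n M column-zero)) ⟩
  M zero zero * det n (minor M zero) + + 0
    ≡⟨ ℤP.+-identityʳ _ ⟩
  M zero zero * det n (minor M zero)
    ∎
  where
  -- The minors of the lower terms have a zero first column, including their head entry.
  lower-terms : ∀ n (M : Matrix (suc n) (suc n)) → (∀ i → M (suc i) zero ≡ + 0) →
                ∀ j → laplaceTerm M (suc j) ≡ + 0
  lower-terms (suc n) M column-zero j = laplaceTerm-vanishes M (suc j)
    (trans (det-first-column n (minor M (suc j)) (column-zero ∘ suc))
           (cong (_* det n (minor (minor M (suc j)) zero)) (column-zero zero)))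

module Elimination {m} (M : Matrix (suc m) (suc m)) (a : ℤ) (c : Fin m → ℤ) where

  eliminated-row : Fin m → Fin (suc m) → ℤ
  eliminated-row i j = a * M (suc i) j - c i * M zero j

  eliminate : Matrix (suc m) (suc m)
  eliminate zero    = M zero
  eliminate (suc i) = eliminated-row i

  private
    eliminate-first : ℕ → Matrix (suc m) (suc m)
    eliminate-first k zero = M zero
    eliminate-first k (suc i) with toℕ i ℕ.<? k
    ... | yes _ = eliminated-row i
    ... | no  _ = M (suc i)

    eliminate-first-zero : ∀ i j → eliminate-first 0 i j ≡ M i j
    eliminate-first-zero zero    j = refl
    eliminate-first-zero (suc i) j with toℕ i ℕ.<? 0
    ... | no _ = refl

    eliminate-first-all : ∀ i j → eliminate-first m i j ≡ eliminate i j
    eliminate-first-all zero    j = refl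
    eliminate-first-all (suc i) j with toℕ i ℕ.<? m
    ... | yes _    = refl
    ... | no  i≮m = ⊥-elim (i≮m (FinP.toℕ<n i))

    det-eliminate-first : ∀ k → k ℕ.≤ m → det (suc m) (eliminate-first k) ≡ a ^ k * det (suc m) M
    det-eliminate-first zero    _   = trans (det-cong (suc m) eliminate-first-zero) (sym (ℤP.*-identityˡ _))
    det-eliminate-first (suc k) k<m = begin-equality
      det (suc m) (eliminate-first (suc k))  ≡⟨ det-row-operation (suc m) (eliminate-first k) (eliminate-first (suc k))
                                                  (suc r) zero (λ ()) a (c r) off-r row-r ⟩
      a * det (suc m) (eliminate-first k)    ≡⟨ cong (a *_) (det-eliminate-first k (ℕP.<⇒≤ k<m)) ⟩
      a * (a ^ k * det (suc m) M)            ≡⟨ ℤP.*-assoc a (a ^ k) (det (suc m) M) ⟨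
      a ^ suc k * det (suc m) M              ∎
      where
      r : Fin m
      r = Fin.fromℕ< k<m

      toℕ-r : toℕ r ≡ k
      toℕ-r = FinP.toℕ-fromℕ< k<m

      off-r : ∀ i → i ≢ suc r → ∀ j → eliminate-first (suc k) i j ≡ eliminate-first k i j
      off-r zero    _      j = refl
      off-r (suc i) i≢r j with toℕ i ℕ.<? suc k | toℕ i ℕ.<? k
      ... | yes _   | yes _  = refl
      ... | no  _   | no  _  = refl
      ... | yes i<1+k | no i≮k = ⊥-elim (i≢r (cong suc (FinP.toℕ-injective (trans i≡k (sym toℕ-r)))))
        where
        i≡k : toℕ i ≡ k
        i≡k = ℕP.≤-antisym (ℕP.m<1+n⇒m≤n i<1+k) (ℕP.≮⇒≥ i≮k)
      ... | no  i≮1+k | yes i<k = ⊥-elim (i≮1+k (ℕP.m<n⇒m<1+n i<k))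

      row-r : ∀ j → eliminate-first (suc k) (suc r) j ≡
                    a * eliminate-first k (suc r) j - c r * eliminate-first k zero j
      row-r j with toℕ r ℕ.<? suc k | toℕ r ℕ.<? k
      ... | yes _     | no _    = refl
      ... | no  r≮1+k | _       = ⊥-elim (r≮1+k (ℕP.≤-reflexive (cong suc toℕ-r)))
      ... | yes _     | yes r<k = ⊥-elim (ℕP.<-irrefl toℕ-r r<k)

  det-eliminate : det (suc m) eliminate ≡ a ^ m * det (suc m) M
  det-eliminate =
    trans (det-cong (suc m) (λ i j → sym (eliminate-first-all i j))) (det-eliminate-first m ℕP.≤-refl)

-- Hadamard's inequality for Gram matrices

productℤ-cong : ∀ n {f g : Fin n → ℤ} → (∀ i → f i ≡ g i) → productℤ f ≡ productℤ g
productℤ-cong zero    eq = refl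
productℤ-cong (suc n) eq = cong₂ _*_ (eq zero) (productℤ-cong n (eq ∘ suc))

productℤ-scale : ∀ n c (f : Fin n → ℤ) → productℤ (λ i → c * f i) ≡ c ^ n * productℤ f
productℤ-scale zero    c f = refl
productℤ-scale (suc n) c f = begin-equality
  (c * f zero) * productℤ (λ i → c * f (suc i))  ≡⟨ cong ((c * f zero) *_) (productℤ-scale n c (f ∘ suc)) ⟩
  (c * f zero) * (c ^ n * productℤ (f ∘ suc))    ≡⟨ interchange c (f zero) (c ^ n) (productℤ (f ∘ suc)) ⟩
  (c * c ^ n) * (f zero * productℤ (f ∘ suc))    ∎
  where
  interchange : ∀ a b c d → (a * b) * (c * d) ≡ (a * c) * (b * d)
  interchange = solve-∀

*-monoˡ-≤-≥0 : ∀ c {x y} → + 0 ≤ c → x ≤ y → c * x ≤ c * y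
*-monoˡ-≤-≥0 c c≥0 = ℤP.*-monoˡ-≤-nonNeg c {{ℤ.nonNegative c≥0}}

*-cancelˡ-≤->0 : ∀ c {x y} → + 0 < c → c * x ≤ c * y → x ≤ y
*-cancelˡ-≤->0 c {x} {y} c>0 = ℤP.*-cancelˡ-≤-pos x y c {{ℤ.positive c>0}}

*-nonNeg : ∀ {x y} → + 0 ≤ x → + 0 ≤ y → + 0 ≤ x * y
*-nonNeg {x} {y} x≥0 y≥0 = subst (_≤ x * y) (ℤP.*-zeroʳ x) (*-monoˡ-≤-≥0 x x≥0 y≥0)

^-positive : ∀ {c} n → + 0 < c → + 0 < c ^ n
^-positive zero    c>0 = ℤ.+<+ (ℕ.s≤s ℕ.z≤n)
^-positive {c} (suc n) c>0 =
  subst (_< c * c ^ n) (ℤP.*-zeroʳ c) (ℤP.*-monoˡ-<-pos c {{ℤ.positive c>0}} (^-positive n c>0))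

productℤ-nonNeg : ∀ n (f : Fin n → ℤ) → (∀ i → + 0 ≤ f i) → + 0 ≤ productℤ f
productℤ-nonNeg zero    f f≥0 = ℤ.+≤+ ℕ.z≤n
productℤ-nonNeg (suc n) f f≥0 = *-nonNeg (f≥0 zero) (productℤ-nonNeg n (f ∘ suc) (f≥0 ∘ suc))

productℤ-mono : ∀ n (f g : Fin n → ℤ) → (∀ i → + 0 ≤ f i) → (∀ i → f i ≤ g i) →
                productℤ f ≤ productℤ g
productℤ-mono zero    f g f≥0 f≤g = ℤP.≤-refl
productℤ-mono (suc n) f g f≥0 f≤g = begin
  f zero * productℤ (f ∘ suc)
    ≤⟨ *-monoˡ-≤-≥0 (f zero) (f≥0 zero) (productℤ-mono n (f ∘ suc) (g ∘ suc) (f≥0 ∘ suc) (f≤g ∘ suc)) ⟩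
  f zero * productℤ (g ∘ suc)
    ≤⟨ ℤP.*-monoʳ-≤-nonNeg (productℤ (g ∘ suc)) {{ℤ.nonNegative g-tail≥0}} (f≤g zero) ⟩
  g zero * productℤ (g ∘ suc)
    ∎
  where
  g-tail≥0 : + 0 ≤ productℤ (g ∘ suc)
  g-tail≥0 = productℤ-nonNeg n (g ∘ suc) (λ i → ℤP.≤-trans (f≥0 (suc i)) (f≤g (suc i)))

dot : ∀ {s} → (Fin s → ℤ) → (Fin s → ℤ) → ℤ
dot {s} u v = sumℤ s (λ k → u k * v k)

dot-comm : ∀ {s} (u v : Fin s → ℤ) → dot u v ≡ dot v u
dot-comm {s} u v = sumℤ-cong s (λ k → ℤP.*-comm (u k) (v k))

dot-bilinear : ∀ {s} a b c d (x y r : Fin s → ℤ) →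
               dot (λ k → a * x k - b * r k) (λ k → c * y k - d * r k) ≡
               ((a * c) * dot x y + - (a * d) * dot x r) + (- (b * c) * dot r y + (b * d) * dot r r)
dot-bilinear {s} a b c d x y r = begin-equality
  sumℤ s (λ k → (a * x k - b * r k) * (c * y k - d * r k))
    ≡⟨ sumℤ-cong s (λ k → expand a b c d (x k) (y k) (r k)) ⟩
  sumℤ s (λ k → ((a * c) * (x k * y k) + - (a * d) * (x k * r k)) +
                (- (b * c) * (r k * y k) + (b * d) * (r k * r k)))
    ≡⟨ sumℤ-distrib-+ s _ _ ⟩
  sumℤ s (λ k → (a * c) * (x k * y k) + - (a * d) * (x k * r k)) +
  sumℤ s (λ k → - (b * c) * (r k * y k) + (b * d) * (r k * r k))
    ≡⟨ cong₂ _+_ (sumℤ-linear s (a * c) (- (a * d)) (λ k → x k * y k) (λ k → x k * r k))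
               (sumℤ-linear s (- (b * c)) (b * d) (λ k → r k * y k) (λ k → r k * r k)) ⟩
  ((a * c) * dot x y + - (a * d) * dot x r) + (- (b * c) * dot r y + (b * d) * dot r r)
    ∎
  where
  expand : ∀ a b c d x y r → (a * x - b * r) * (c * y - d * r) ≡
           ((a * c) * (x * y) + - (a * d) * (x * r)) + (- (b * c) * (r * y) + (b * d) * (r * r))
  expand = solve-∀

gram : ∀ {m s} → Matrix m s → Matrix m m
gram A = A · transpose A

i*i≡∣i∣*∣i∣ : ∀ i → i * i ≡ + (∣ i ∣ ℕ.* ∣ i ∣)
i*i≡∣i∣*∣i∣ (+ n)     = sym (ℤP.pos-* n n)
i*i≡∣i∣*∣i∣ ℤ.-[1+ n ] = refl

sumℤ-pos : ∀ n (f : Fin n → ℕ) → sumℤ n (λ i → + f i) ≡ + sumℕ n f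
sumℤ-pos zero    f = refl
sumℤ-pos (suc n) f = trans (cong (_+_ (+ f zero)) (sumℤ-pos n (f ∘ suc))) (sym (ℤP.pos-+ (f zero) _))

productℤ-pos : ∀ n (f : Fin n → ℕ) → productℤ (λ i → + f i) ≡ + productℕ f
productℤ-pos zero    f = refl
productℤ-pos (suc n) f = trans (cong (+ f zero *_) (productℤ-pos n (f ∘ suc))) (sym (ℤP.pos-* (f zero) _))

dot-self : ∀ {s} (v : Fin s → ℤ) → dot v v ≡ + ‖ v ‖²
dot-self {s} v = trans (sumℤ-cong s (λ k → i*i≡∣i∣*∣i∣ (v k))) (sumℤ-pos s _)

dot-self-nonNeg : ∀ {s} (v : Fin s → ℤ) → + 0 ≤ dot v v
dot-self-nonNeg v = subst (+ 0 ≤_) (sym (dot-self v)) (ℤ.+≤+ ℕ.z≤n)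

‖‖²≡0⇒≡0 : ∀ {s} (v : Fin s → ℤ) → ‖ v ‖² ≡ 0 → ∀ k → v k ≡ + 0
‖‖²≡0⇒≡0 {suc s} v norm≡0 zero with ℕP.m*n≡0⇒m≡0∨n≡0 ∣ v zero ∣ (ℕP.m+n≡0⇒m≡0 _ norm≡0)
... | inj₁ ∣v₀∣≡0 = ℤP.∣i∣≡0⇒i≡0 ∣v₀∣≡0
... | inj₂ ∣v₀∣≡0 = ℤP.∣i∣≡0⇒i≡0 ∣v₀∣≡0
‖‖²≡0⇒≡0 {suc s} v norm≡0 (suc k) = ‖‖²≡0⇒≡0 (v ∘ suc) (ℕP.m+n≡0⇒n≡0 _ norm≡0) k

module HadamardStep {m s} (A : Matrix (suc m) s) (a>0 : + 0 < gram A zero zero)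
                    (hadamard-below : ∀ (B : Matrix m s) → det m (gram B) ≤ productℤ (λ i → gram B i i)) where

  private
    G : Matrix (suc m) (suc m)
    G = gram A

    a : ℤ
    a = G zero zero

    b : Fin m → ℤ
    b i = G (suc i) zero

    open Elimination G a b using (eliminate; det-eliminate)

    N : Matrix m m
    N = minor eliminate zero

    A′ : Matrix m s
    A′ i k = a * A (suc i) k - b i * A zero k

    a≥0 : + 0 ≤ a
    a≥0 = ℤP.<⇒≤ a>0

    gram-A′ : ∀ i j → gram A′ i j ≡ a * N i j
    gram-A′ i j = trans (dot-bilinear a (b i) a (b j) (A (suc i)) (A (suc j)) (A zero))
                        (factor a (G (suc i) (suc j)) (b i) (b j) (G zero (suc j)))
      where
      factor : ∀ a g bi bj g₀ → ((a * a) * g + - (a * bj) * bi) + (- (bi * a) * g₀ + (bi * bj) * a) ≡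
                                a * (a * g - bi * g₀)
      factor = solve-∀

    det-G : a ^ m * det (suc m) G ≡ a * det m N
    det-G = trans (sym det-eliminate) (det-first-column m eliminate (λ i → cancel a (b i)))
      where
      cancel : ∀ a b → a * b - b * a ≡ + 0
      cancel = solve-∀

    det-N≤ : det m N ≤ productℤ (λ i → N i i)
    det-N≤ = *-cancelˡ-≤->0 (a ^ m) (^-positive m a>0) (begin
      a ^ m * det m N                  ≡⟨ det-scale m a (gram A′) N gram-A′ ⟨
      det m (gram A′)                  ≤⟨ hadamard-below A′ ⟩
      productℤ (λ i → gram A′ i i)     ≡⟨ productℤ-cong m (λ i → gram-A′ i i) ⟩
      productℤ (λ i → a * N i i)       ≡⟨ productℤ-scale m a (λ i → N i i) ⟩
      a ^ m * productℤ (λ i → N i i)   ∎)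

    N-diagonal-nonNeg : ∀ i → + 0 ≤ N i i
    N-diagonal-nonNeg i = *-cancelˡ-≤->0 a a>0
      (subst₂ _≤_ (sym (ℤP.*-zeroʳ a)) (gram-A′ i i) (dot-self-nonNeg (A′ i)))

    N-diagonal≤ : ∀ i → N i i ≤ a * G (suc i) (suc i)
    N-diagonal≤ i = ℤP.i≤j⇒i-k≤j (b i * G zero (suc i)) {{ℤ.nonNegative b²≥0}} ℤP.≤-refl
      where
      b²≥0 : + 0 ≤ b i * G zero (suc i)
      b²≥0 = subst (+ 0 ≤_) (sym (trans (cong (b i *_) (dot-comm (A zero) (A (suc i)))) (i*i≡∣i∣*∣i∣ (b i))))
                   (ℤ.+≤+ ℕ.z≤n)

    prod-N≤ : productℤ (λ i → N i i) ≤ a ^ m * productℤ (λ i → G (suc i) (suc i))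
    prod-N≤ = begin
      productℤ (λ i → N i i)                         ≤⟨ productℤ-mono m _ _ N-diagonal-nonNeg N-diagonal≤ ⟩
      productℤ (λ i → a * G (suc i) (suc i))         ≡⟨ productℤ-scale m a (λ i → G (suc i) (suc i)) ⟩
      a ^ m * productℤ (λ i → G (suc i) (suc i))     ∎

  hadamard-step : det (suc m) (gram A) ≤ productℤ (λ i → gram A i i)
  hadamard-step = *-cancelˡ-≤->0 (a ^ m) (^-positive m a>0) (begin
    a ^ m * det (suc m) G             ≡⟨ det-G ⟩
    a * det m N                       ≤⟨ *-monoˡ-≤-≥0 a a≥0 det-N≤ ⟩
    a * productℤ (λ i → N i i)        ≤⟨ *-monoˡ-≤-≥0 a a≥0 prod-N≤ ⟩
    a * (a ^ m * P)                   ≡⟨ swap-scalars a (a ^ m) P ⟩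
    a ^ m * (a * P)                   ∎)
    where
    P : ℤ
    P = productℤ (λ i → G (suc i) (suc i))
    swap-scalars : ∀ a c p → a * (c * p) ≡ c * (a * p)
    swap-scalars = solve-∀

hadamard : ∀ m {s} (A : Matrix m s) → det m (gram A) ≤ productℤ (λ i → gram A i i)
hadamard zero    A = ℤP.≤-refl
hadamard (suc m) A with ‖ A zero ‖² in norm≡
... | zero  = subst (_≤ productℤ (λ i → gram A i i)) (sym (det-zero-row (suc m) zero (gram A) zero-row))
                    (productℤ-nonNeg (suc m) (λ i → gram A i i) (λ i → dot-self-nonNeg (A i)))
  where
  zero-row : ∀ j → gram A zero j ≡ + 0
  zero-row j = sumℤ-zero _ (λ k → cong (_* A j k) (‖‖²≡0⇒≡0 (A zero) norm≡ k))
... | suc _ = HadamardStep.hadamard-step A a>0 (hadamard m)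
  where
  a>0 : + 0 < gram A zero zero
  a>0 = subst (+ 0 <_) (sym (trans (dot-self (A zero)) (cong +_ norm≡))) (ℤ.+<+ (ℕ.s≤s ℕ.z≤n))

hadamard-‖‖² : ∀ {m s} (A : Matrix m s) → det m (gram A) ≤ + productℕ (λ i → ‖ A i ‖²)
hadamard-‖‖² {m} A = begin
  det m (gram A)                         ≤⟨ hadamard m A ⟩
  productℤ (λ i → gram A i i)            ≡⟨ productℤ-cong m (λ i → dot-self (A i)) ⟩
  productℤ (λ i → + ‖ A i ‖²)            ≡⟨ productℤ-pos m (λ i → ‖ A i ‖²) ⟩
  + productℕ (λ i → ‖ A i ‖²)            ∎

pos-^ : ∀ x n → (+ x) ^ n ≡ + (x ℕ.^ n)
pos-^ x zero    = refl
pos-^ x (suc n) = trans (cong (+ x *_) (pos-^ x n)) (sym (ℤP.pos-* x (x ℕ.^ n)))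

lemma15 : (m s : ℕ) (A : Matrix m s) →
          ((+ m) ^ m) * det m (A · transpose A) ≤ ((+ s) ^ m) * ((+ Amax A) ^ (2 ℕ.* m))
lemma15 m s A = begin
  (+ m) ^ m * det m (gram A)                  ≤⟨ *-monoˡ-≤-≥0 ((+ m) ^ m) m^m≥0 (hadamard-‖‖² A) ⟩
  (+ m) ^ m * + P                             ≡⟨ cong (_* + P) (pos-^ m m) ⟩
  + (m ℕ.^ m) * + P                           ≡⟨ ℤP.pos-* (m ℕ.^ m) P ⟨
  + (m ℕ.^ m ℕ.* P)                           ≤⟨ ℤ.+≤+ (amgm-‖‖² A) ⟩
  + (s ℕ.^ m ℕ.* Amax A ℕ.^ (2 ℕ.* m))        ≡⟨ ℤP.pos-* (s ℕ.^ m) (Amax A ℕ.^ (2 ℕ.* m)) ⟩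
  + (s ℕ.^ m) * + (Amax A ℕ.^ (2 ℕ.* m))      ≡⟨ cong₂ _*_ (pos-^ s m) (pos-^ (Amax A) (2 ℕ.* m)) ⟨
  (+ s) ^ m * (+ Amax A) ^ (2 ℕ.* m)          ∎
  where
  P : ℕ
  P = productℕ (λ i → ‖ A i ‖²)
  m^m≥0 : + 0 ≤ (+ m) ^ m
  m^m≥0 = subst (+ 0 ≤_) (sym (pos-^ m m)) (ℤ.+≤+ ℕ.z≤n)
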